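{- For every $n$-vertex graph $G$ and for every pair of integers $k,l$ with $\mu(G)\geq k \geq l \geq 0$, we have $$\frac{m(K_n,l)}{m(K_n,k)}\leq \frac{m(G,l)}{m(G,k)}$$ and thus $$\frac{M_{l}(K_n)}{m(K_n,k)} = \frac{\sum_{i=0}^l m(K_n,i)}{m(K_n,k)}\leq \frac{\sum_{i=0}^l m(G,i)}{m(G,k)} = \frac{M_{l}(G)}{m(G,k)}.$$
   Context: A matching of a graph is a set of pairwise vertex-disjoint edges; $m(G,k)$ denotes the number of matchings of cardinality $k$ in $G$, $\mu(G)$ the matching number of $G$, and $M_l(G)=\sum_{i=0}^l m(G,i)$ the number of matchings of cardinality at most $l$. $K_n$ is the complete graph on $n$ vertices. -}

module Defs where

open import Data.Nat using (ℕ; zero; suc; _+_; _*_; _≤_; _<_; _⊔_)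
open import Data.Bool using (Bool; true; false; not; _∧_; if_then_else_)
open import Data.Fin using (Fin; toℕ)
open import Data.Fin.Properties using () renaming (_≟_ to _≟ᶠ_)
open import Data.Nat.Properties using (_<?_)
open import Data.List using (List; []; _∷_; _++_; length; filter; map; concatMap; allFin; upTo; foldr)
open import Data.Nat.ListAction using (sum)
open import Data.Product using (_×_; _,_)
open import Relation.Nullary.Decidable using (⌊_⌋; does)
open import Relation.Binary.PropositionalEquality using (_≡_; refl) renaming (sym to ≡-sym)
open import Relation.Nullary using (yes; no)
open import Data.Empty using (⊥-elim)
open import Data.Bool.Properties using (T?)

record Graph (n : ℕ) : Set where
  field
    adj    : Fin n → Fin n → Bool
    sym    : ∀ i j → adj i j ≡ adj j i
    irrefl : ∀ i → adj i i ≡ false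
open Graph public

neqᵇ : ∀ {n} → Fin n → Fin n → Bool
neqᵇ i j = not ⌊ i ≟ᶠ j ⌋

private
  neq-sym : ∀ {n} (i j : Fin n) → neqᵇ i j ≡ neqᵇ j i
  neq-sym i j with i ≟ᶠ j | j ≟ᶠ i
  ... | yes _ | yes _ = refl
  ... | no _  | no _  = refl
  ... | yes p | no q = ⊥-elim (q (≡-sym p))
  ... | no p  | yes q = ⊥-elim (p (≡-sym q))

  neq-irr : ∀ {n} (i : Fin n) → neqᵇ i i ≡ false
  neq-irr i with i ≟ᶠ i
  ... | yes _ = refl
  ... | no p = ⊥-elim (p refl)

K : (n : ℕ) → Graph n
K n = record { adj = neqᵇ ; sym = neq-sym ; irrefl = neq-irr }

Edge : ℕ → Set
Edge n = Fin n × Fin n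

-- Edge set of G: each edge {i,j} listed once as (i , j) with i < j.
edges : ∀ {n} → Graph n → List (Edge n)
edges {n} G =
  concatMap (λ i → map (λ j → (i , j))
    (filter (λ j → T? (⌊ toℕ i <? toℕ j ⌋ ∧ adj G i j)) (allFin n)))
    (allFin n)

subsets : ∀ {A : Set} → ℕ → List A → List (List A)
subsets zero    _        = [] ∷ []
subsets (suc k) []       = []
subsets (suc k) (x ∷ xs) = map (x ∷_) (subsets k xs) ++ subsets (suc k) xs

disjointᵇ : ∀ {n} → Edge n → Edge n → Bool
disjointᵇ (a , b) (c , d) = neqᵇ a c ∧ neqᵇ a d ∧ neqᵇ b c ∧ neqᵇ b d

pairwiseDisjointᵇ : ∀ {n} → List (Edge n) → Bool
pairwiseDisjointᵇ []       = true
pairwiseDisjointᵇ (e ∷ es) = foldr (λ f r → disjointᵇ e f ∧ r) true es ∧ pairwiseDisjointᵇ es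

m : ∀ {n} → Graph n → ℕ → ℕ
m G k = length (filter (λ s → T? (pairwiseDisjointᵇ s)) (subsets k (edges G)))

-- μ(G): matching number = largest k with m(G,k) > 0
-- (k ranges over 0..n, since any matching has at most n edges ... and m(G,0)=1).
μ : ∀ {n} → Graph n → ℕ
μ {n} G = foldr (λ k r → (if ⌊ 0 <? m G k ⌋ then k else 0) ⊔ r) 0 (upTo (suc n))

M : ∀ {n} → Graph n → ℕ → ℕ
M G l = sum (map (m G) (upTo (suc l)))

module Submission where

-- Double counting pairs (S, e) of a k-matching S and an edge e disjoint from it gives
-- (k+1)·m(G,k+1) = Σ_S #{edges of G avoiding S}. A k-matching leaves n−2k vertices
-- uncovered, so each summand is at most C(n−2k,2), with equality for K_n. Hence
-- (k+1)·m(K_n,k+1) = m(K_n,k)·C(n−2k,2) while (k+1)·m(G,k+1) ≤ m(G,k)·C(n−2k,2),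
-- so m(G,k)/m(K_n,k) is non-increasing in k; summing over i ≤ l gives the bound for M.

open import Defs hiding (sym)
open import Data.Nat using (ℕ; zero; suc; _+_; _*_; _∸_; _≤_; z≤n; _<ᵇ_; _≤′_; ≤′-refl; ≤′-step)
open import Data.Nat.Combinatorics using (_C_; nC1≡n; nCk+nC[k+1]≡[n+1]C[k+1])
open import Data.Nat.Properties
  using (_<?_; +-assoc; +-comm; +-identityʳ; +-mono-≤; *-zeroʳ; *-comm; *-assoc; *-distribʳ-+;
         *-cancelˡ-≤; *-monoʳ-≤; *-monoˡ-≤; m+n∸n≡m; m<1+n⇒m≤n; ≤⇒≤′;
         ≤-refl; ≤-reflexive; ≤-trans; module ≤-Reasoning)
open import Data.Nat.ListAction using (sum)
open import Data.Nat.ListAction.Properties using (sum-++)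
open import Data.Nat.Tactic.RingSolver using (solve-∀)
open import Data.Bool using (Bool; true; false; not; _∧_; if_then_else_)
open import Data.Bool.Properties using (∧-zeroʳ; ∧-identityʳ; ∧-assoc)
open import Data.List using (List; []; _∷_; _++_; map; concat; filterᵇ; length; allFin; foldr)
open import Data.Fin as Fin using (Fin; toℕ)
open import Data.Fin.Properties using (_≟_; suc-injective)
open import Data.Bool.ListAction using (all)
open import Data.Bool.Solver using (module ∨-∧-Solver)
open import Data.List.Properties using (map-++; map-cong; map-∘; map-tabulate; length-tabulate)
open import Data.List.Relation.Unary.All as All using (All; []; _∷_)
open import Data.List.Relation.Unary.All.Properties using (++⁺; map⁺; concat⁺; tabulate⁺; applyUpTo⁺₁)
open import Data.Product using (_×_; _,_; proj₁; proj₂)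
open import Function using (_∘_; id)
open import Function.Bundles using (mk⇔)
open import Relation.Nullary using (yes; no; contradiction)
open import Relation.Nullary.Decidable using (⌊_⌋; isYes≗does; dec-true; does-⇔; ⌊⌋-map′)
open import Relation.Binary.PropositionalEquality

open ∨-∧-Solver using (solve; _:*_; _:=_)

module _ {A : Set} where

  sum-map-++ : ∀ (f : A → ℕ) xs ys → sum (map f (xs ++ ys)) ≡ sum (map f xs) + sum (map f ys)
  sum-map-++ f xs ys = trans (cong sum (map-++ f xs ys)) (sum-++ (map f xs) (map f ys))

  sum-map-cong : ∀ {f g : A → ℕ} → (∀ x → f x ≡ g x) → ∀ xs → sum (map f xs) ≡ sum (map g xs)
  sum-map-cong f≗g xs = cong sum (map-cong f≗g xs)

  sum-map-mono : ∀ {f g : A → ℕ} → (∀ x → f x ≤ g x) → ∀ xs → sum (map f xs) ≤ sum (map g xs)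
  sum-map-mono f≤g []       = z≤n
  sum-map-mono f≤g (x ∷ xs) = +-mono-≤ (f≤g x) (sum-map-mono f≤g xs)

  sum-map-+ : ∀ (f g : A → ℕ) xs → sum (map (λ x → f x + g x) xs) ≡ sum (map f xs) + sum (map g xs)
  sum-map-+ f g []       = refl
  sum-map-+ f g (x ∷ xs) = trans (cong (f x + g x +_) (sum-map-+ f g xs)) (interchange (f x) (g x) _ _)
    where
    interchange : ∀ a b c d → (a + b) + (c + d) ≡ (a + c) + (b + d)
    interchange = solve-∀

  sum-map-zero : ∀ xs → sum (map (λ (_ : A) → 0) xs) ≡ 0
  sum-map-zero []       = refl
  sum-map-zero (x ∷ xs) = sum-map-zero xs

  sum-map-concat : ∀ (f : A → ℕ) xss → sum (map f (concat xss)) ≡ sum (map (sum ∘ map f) xss)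
  sum-map-concat f []         = refl
  sum-map-concat f (xs ∷ xss) =
    trans (sum-map-++ f xs (concat xss)) (cong (sum (map f xs) +_) (sum-map-concat f xss))

  sumWhere : (A → Bool) → (A → ℕ) → List A → ℕ
  sumWhere p w xs = sum (map (λ x → if p x then w x else 0) xs)

  count : (A → Bool) → List A → ℕ
  count p = sumWhere p (λ _ → 1)

  sum-map-filterᵇ : ∀ (f : A → ℕ) p xs → sum (map f (filterᵇ p xs)) ≡ sumWhere p f xs
  sum-map-filterᵇ f p []       = refl
  sum-map-filterᵇ f p (x ∷ xs) with p x
  ... | true  = cong (f x +_) (sum-map-filterᵇ f p xs)
  ... | false = sum-map-filterᵇ f p xs

  count-cong : ∀ {p q : A → Bool} → (∀ x → p x ≡ q x) → ∀ xs → count p xs ≡ count q xs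
  count-cong p≗q = sum-map-cong (λ x → cong (λ b → if b then 1 else 0) (p≗q x))

  count-false : ∀ xs → count (λ _ → false) xs ≡ 0
  count-false = sum-map-zero

  count-∧ˡ : ∀ b (p : A → Bool) xs → count (λ x → b ∧ p x) xs ≡ (if b then count p xs else 0)
  count-∧ˡ true  p xs = refl
  count-∧ˡ false p xs = count-false xs

  count-∧ʳ : ∀ (p : A → Bool) b xs → count (λ x → p x ∧ b) xs ≡ (if b then count p xs else 0)
  count-∧ʳ p true  xs = count-cong (λ x → ∧-identityʳ (p x)) xs
  count-∧ʳ p false xs = trans (count-cong (λ x → ∧-zeroʳ (p x)) xs) (count-false xs)

  count-true : ∀ xs → count (λ _ → true) xs ≡ length xs
  count-true []       = refl
  count-true (x ∷ xs) = cong suc (count-true xs)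

  count-mono : ∀ {p q : A → Bool} → (∀ x → p x ≡ true → q x ≡ true) →
               ∀ xs → count p xs ≤ count q xs
  count-mono {p} {q} p⇒q = sum-map-mono indicator-mono
    where
    indicator-mono : ∀ x → (if p x then 1 else 0) ≤ (if q x then 1 else 0)
    indicator-mono x with p x in px
    ... | false = z≤n
    ... | true rewrite p⇒q x px = ≤-refl

  count-filterᵇ : ∀ p q (xs : List A) → count q (filterᵇ p xs) ≡ count (λ x → p x ∧ q x) xs
  count-filterᵇ p q []       = refl
  count-filterᵇ p q (x ∷ xs) with p x
  ... | true  = cong ((if q x then 1 else 0) +_) (count-filterᵇ p q xs)
  ... | false = count-filterᵇ p q xs

  length-filterᵇ : ∀ p (xs : List A) → length (filterᵇ p xs) ≡ count p xs
  length-filterᵇ p []       = refl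
  length-filterᵇ p (x ∷ xs) with p x
  ... | true  = cong suc (length-filterᵇ p xs)
  ... | false = length-filterᵇ p xs

  filterᵇ-comm : ∀ p q (xs : List A) → filterᵇ p (filterᵇ q xs) ≡ filterᵇ q (filterᵇ p xs)
  filterᵇ-comm p q [] = refl
  filterᵇ-comm p q (x ∷ xs) with p x in px | q x in qx
  ... | true  | true  rewrite px | qx = cong (x ∷_) (filterᵇ-comm p q xs)
  ... | true  | false rewrite qx      = filterᵇ-comm p q xs
  ... | false | true  rewrite px      = filterᵇ-comm p q xs
  ... | false | false                 = filterᵇ-comm p q xs

  sumWhere-≤ : ∀ {P : A → Set} p w b → (∀ x → p x ≡ true → P x → w x ≤ b) →
               ∀ {xs} → All P xs → sumWhere p w xs ≤ count p xs * b
  sumWhere-≤ p w b bound []                = z≤n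
  sumWhere-≤ p w b bound {x ∷ xs} (Px ∷ Pxs) with p x in px
  ... | true  = +-mono-≤ (bound x px Px) (sumWhere-≤ p w b bound Pxs)
  ... | false = sumWhere-≤ p w b bound Pxs

  sumWhere-≡ : ∀ {P : A → Set} p w b → (∀ x → p x ≡ true → P x → w x ≡ b) →
               ∀ {xs} → All P xs → sumWhere p w xs ≡ count p xs * b
  sumWhere-≡ p w b exact []                = refl
  sumWhere-≡ p w b exact {x ∷ xs} (Px ∷ Pxs) with p x in px
  ... | true  = cong₂ _+_ (exact x px Px) (sumWhere-≡ p w b exact Pxs)
  ... | false = sumWhere-≡ p w b exact Pxs

module _ {A B : Set} where

  sum-map-swap : ∀ (f : A → B → ℕ) xs ys →
                 sum (map (λ x → sum (map (f x) ys)) xs) ≡ sum (map (λ y → sum (map (λ x → f x y) xs)) ys)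
  sum-map-swap f []       ys = sym (sum-map-zero ys)
  sum-map-swap f (x ∷ xs) ys =
    trans (cong (sum (map (f x) ys) +_) (sum-map-swap f xs ys))
          (sym (sum-map-+ (f x) (λ y → sum (map (λ x → f x y) xs)) ys))

  sum-map-map : ∀ (f : B → ℕ) (g : A → B) xs → sum (map f (map g xs)) ≡ sum (map (f ∘ g) xs)
  sum-map-map f g xs = cong sum (sym (map-∘ xs))

  count-map : ∀ (p : B → Bool) (g : A → B) xs → count p (map g xs) ≡ count (p ∘ g) xs
  count-map p g = sum-map-map (λ y → if p y then 1 else 0) g

module _ {A : Set} where

  subsets-All : ∀ {P : A → Set} k {xs} → All P xs → All (λ S → length S ≡ k × All P S) (subsets k xs)
  subsets-All zero    _          = (refl , []) ∷ []
  subsets-All (suc k) []         = []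
  subsets-All (suc k) (Px ∷ Pxs) =
    ++⁺ (map⁺ (All.map (λ (|S|≡k , PS) → cong suc |S|≡k , Px ∷ PS) (subsets-All k Pxs)))
        (subsets-All (suc k) Pxs)

  count-subsets-∷ : ∀ (q : List A → Bool) k x xs →
    count q (subsets (suc k) (x ∷ xs)) ≡ count (q ∘ (x ∷_)) (subsets k xs) + count q (subsets (suc k) xs)
  count-subsets-∷ q k x xs =
    trans (sum-map-++ _ (map (x ∷_) (subsets k xs)) _)
          (cong (_+ count q (subsets (suc k) xs)) (count-map q (x ∷_) (subsets k xs)))

  count-subsets-filterᵇ : ∀ (p : A → Bool) (q : List A → Bool) k xs →
    count (λ S → all p S ∧ q S) (subsets k xs) ≡ count q (subsets k (filterᵇ p xs))
  count-subsets-filterᵇ p q zero    xs       = refl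
  count-subsets-filterᵇ p q (suc k) []       = refl
  count-subsets-filterᵇ p q (suc k) (y ∷ ys) with p y in py
  ... | true  = begin
    count (λ S → all p S ∧ q S) (subsets (suc k) (y ∷ ys))
      ≡⟨ count-subsets-∷ _ k y ys ⟩
    count (λ S → (p y ∧ all p S) ∧ q (y ∷ S)) (subsets k ys)
      + count (λ S → all p S ∧ q S) (subsets (suc k) ys)
      ≡⟨ cong₂ _+_ (trans (count-cong (λ S → cong (λ b → (b ∧ all p S) ∧ q (y ∷ S)) py) (subsets k ys))
                          (count-subsets-filterᵇ p (q ∘ (y ∷_)) k ys))
                   (count-subsets-filterᵇ p q (suc k) ys) ⟩
    count (q ∘ (y ∷_)) (subsets k (filterᵇ p ys)) + count q (subsets (suc k) (filterᵇ p ys))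
      ≡⟨ count-subsets-∷ q k y (filterᵇ p ys) ⟨
    count q (subsets (suc k) (y ∷ filterᵇ p ys)) ∎
    where open ≡-Reasoning
  ... | false = begin
    count (λ S → all p S ∧ q S) (subsets (suc k) (y ∷ ys))
      ≡⟨ count-subsets-∷ _ k y ys ⟩
    count (λ S → (p y ∧ all p S) ∧ q (y ∷ S)) (subsets k ys)
      + count (λ S → all p S ∧ q S) (subsets (suc k) ys)
      ≡⟨ cong₂ _+_ (trans (count-cong (λ S → cong (λ b → (b ∧ all p S) ∧ q (y ∷ S)) py) (subsets k ys))
                          (count-false (subsets k ys)))
                   (count-subsets-filterᵇ p q (suc k) ys) ⟩
    count q (subsets (suc k) (filterᵇ p ys)) ∎
    where open ≡-Reasoning

module Cliques {A : Set} (R : A → A → Bool)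
               (R-sym : ∀ a b → R a b ≡ R b a) (R-irrefl : ∀ a → R a a ≡ false) where

  isClique : List A → Bool
  isClique []       = true
  isClique (x ∷ xs) = all (R x) xs ∧ isClique xs

  cliques : ℕ → List A → ℕ
  cliques k xs = count isClique (subsets k xs)

  neighbours : A → List A → List A
  neighbours a = filterᵇ (R a)

  extensions : List A → List A → ℕ
  extensions xs S = count (λ a → all (R a) S) xs

  cliques-∷ : ∀ k x xs → cliques (suc k) (x ∷ xs) ≡ cliques k (neighbours x xs) + cliques (suc k) xs
  cliques-∷ k x xs = trans (count-subsets-∷ isClique k x xs)
    (cong (_+ cliques (suc k) xs) (count-subsets-filterᵇ (R x) isClique k xs))

  cliques-1 : ∀ xs → cliques 1 xs ≡ sum (map (λ _ → 1) xs)
  cliques-1 []       = refl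
  cliques-1 (x ∷ xs) = cong suc (cliques-1 xs)

  cliques-neighbours-∷ : ∀ k a x xs → cliques (suc k) (neighbours a (x ∷ xs)) ≡
    cliques (suc k) (neighbours a xs) + (if R a x then cliques k (neighbours x (neighbours a xs)) else 0)
  cliques-neighbours-∷ k a x xs with R a x
  ... | true  = trans (cliques-∷ k x (neighbours a xs)) (+-comm (cliques k (neighbours x (neighbours a xs))) _)
  ... | false = sym (+-identityʳ _)

  -- Each (k+1)-clique is counted k+1 times, once from each of its vertices a
  -- as a k-clique in the neighbourhood of a.
  cliques-neighbourhood-sum : ∀ k xs →
    suc k * cliques (suc k) xs ≡ sum (map (λ a → cliques k (neighbours a xs)) xs)
  cliques-neighbourhood-sum zero    xs       = trans (+-identityʳ _) (cliques-1 xs)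
  cliques-neighbourhood-sum (suc k) []       = *-zeroʳ (suc (suc k))
  cliques-neighbourhood-sum (suc k) (x ∷ xs) = begin
    suc (suc k) * cliques (suc (suc k)) (x ∷ xs)
      ≡⟨ cong (suc (suc k) *_) (cliques-∷ (suc k) x xs) ⟩
    suc (suc k) * (cliques (suc k) Nx + cliques (suc (suc k)) xs)
      ≡⟨ regroup k (cliques (suc k) Nx) (cliques (suc (suc k)) xs) ⟩
    cliques (suc k) Nx + (suc (suc k) * cliques (suc (suc k)) xs + suc k * cliques (suc k) Nx)
      ≡⟨ cong₂ _+_ (cong (cliques (suc k)) (sym Nx-∷))
                   (cong₂ _+_ (cliques-neighbourhood-sum (suc k) xs)
                              (trans (cliques-neighbourhood-sum k Nx) (sym via-x))) ⟩
    cliques (suc k) (neighbours x (x ∷ xs))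
      + (sum (map (λ a → cliques (suc k) (neighbours a xs)) xs) + sum (map through-x xs))
      ≡⟨ cong (cliques (suc k) (neighbours x (x ∷ xs)) +_)
              (trans (sym (sum-map-+ _ through-x xs))
                     (sum-map-cong (λ a → sym (cliques-neighbours-∷ k a x xs)) xs)) ⟩
    sum (map (λ a → cliques (suc k) (neighbours a (x ∷ xs))) (x ∷ xs)) ∎
    where
    open ≡-Reasoning
    Nx = neighbours x xs
    through-x : A → ℕ
    through-x a = if R a x then cliques k (neighbours x (neighbours a xs)) else 0
    regroup : ∀ j a b → suc (suc j) * (a + b) ≡ a + (suc (suc j) * b + suc j * a)
    regroup = solve-∀
    Nx-∷ : neighbours x (x ∷ xs) ≡ Nx
    Nx-∷ rewrite R-irrefl x = refl
    via-x : sum (map through-x xs) ≡ sum (map (λ a → cliques k (neighbours a Nx)) Nx)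
    via-x = sym (trans (sum-map-filterᵇ _ (R x) xs) (sum-map-cong swap-roles xs))
      where
      swap-roles : ∀ a → (if R x a then cliques k (neighbours a Nx) else 0) ≡ through-x a
      swap-roles a rewrite R-sym x a | filterᵇ-comm (R a) (R x) xs = refl

  cliques-extension-sum : ∀ k xs →
    suc k * cliques (suc k) xs ≡ sumWhere isClique (extensions xs) (subsets k xs)
  cliques-extension-sum k xs = begin
    suc k * cliques (suc k) xs
      ≡⟨ cliques-neighbourhood-sum k xs ⟩
    sum (map (λ a → cliques k (neighbours a xs)) xs)
      ≡⟨ sum-map-cong (λ a → sym (count-subsets-filterᵇ (R a) isClique k xs)) xs ⟩
    sum (map (λ a → count (λ S → all (R a) S ∧ isClique S) (subsets k xs)) xs)
      ≡⟨ sum-map-swap (λ a S → if all (R a) S ∧ isClique S then 1 else 0) xs (subsets k xs) ⟩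
    sum (map (λ S → count (λ a → all (R a) S ∧ isClique S) xs) (subsets k xs))
      ≡⟨ sum-map-cong (λ S → count-∧ʳ (λ a → all (R a) S) (isClique S) xs) (subsets k xs) ⟩
    sumWhere isClique (extensions xs) (subsets k xs) ∎
    where open ≡-Reasoning

sum-map-allFin-suc : ∀ {n} (f : Fin (suc n) → ℕ) →
  sum (map f (allFin (suc n))) ≡ f Fin.zero + sum (map (f ∘ Fin.suc) (allFin n))
sum-map-allFin-suc f =
  cong (f Fin.zero +_) (cong sum (trans (map-tabulate Fin.suc f) (sym (map-tabulate id (f ∘ Fin.suc)))))

neqᵇ-irrefl : ∀ {n} (i : Fin n) → neqᵇ i i ≡ false
neqᵇ-irrefl i = cong not (trans (isYes≗does (i ≟ i)) (dec-true (i ≟ i) refl))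

neqᵇ-sym : ∀ {n} (i j : Fin n) → neqᵇ i j ≡ neqᵇ j i
neqᵇ-sym i j = cong not (trans (isYes≗does (i ≟ j))
  (trans (does-⇔ (mk⇔ sym sym) (i ≟ j) (j ≟ i)) (sym (isYes≗does (j ≟ i)))))

neqᵇ-suc : ∀ {n} (i j : Fin n) → neqᵇ (Fin.suc i) (Fin.suc j) ≡ neqᵇ i j
neqᵇ-suc i j = cong not (⌊⌋-map′ (cong Fin.suc) suc-injective (i ≟ j))

count-allFin-suc : ∀ {n} (p : Fin (suc n) → Bool) →
  count p (allFin (suc n)) ≡ (if p Fin.zero then 1 else 0) + count (p ∘ Fin.suc) (allFin n)
count-allFin-suc p = sum-map-allFin-suc (λ v → if p v then 1 else 0)

-- The order test of Defs.edges, phrased with _<ᵇ_ instead of ⌊ _<?_ ⌋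
-- so that it computes on Fin.suc.
before : ∀ {n} → Fin n → Fin n → Bool
before i j = toℕ i <ᵇ toℕ j

before-irrefl : ∀ {n} (i : Fin n) → before i i ≡ false
before-irrefl i = <ᵇ-irrefl (toℕ i)
  where
  <ᵇ-irrefl : ∀ m → (m <ᵇ m) ≡ false
  <ᵇ-irrefl zero    = refl
  <ᵇ-irrefl (suc m) = <ᵇ-irrefl m

before⇒neqᵇ : ∀ {n} (i j : Fin n) → before i j ≡ true → neqᵇ i j ≡ true
before⇒neqᵇ i j i<j with i ≟ j
... | yes refl = contradiction (trans (sym i<j) (before-irrefl i)) λ ()
... | no _     = refl

before-∧-neqᵇ : ∀ {n} (i j : Fin n) → before i j ∧ neqᵇ i j ≡ before i j
before-∧-neqᵇ i j with before i j in i<j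
... | true  = before⇒neqᵇ i j i<j
... | false = refl

choose-2-suc : ∀ b c → (if b then c else 0) + c C 2 ≡ ((if b then 1 else 0) + c) C 2
choose-2-suc true  c = trans (cong (_+ c C 2) (sym (nC1≡n c))) (nCk+nC[k+1]≡[n+1]C[k+1] c 1)
choose-2-suc false c = refl

countPairs : ∀ {n} → (Fin n → Fin n → Bool) → ℕ
countPairs {n} r = sum (map (λ i → count (r i) (allFin n)) (allFin n))

countPairs-cong : ∀ {n} {r s : Fin n → Fin n → Bool} → (∀ i j → r i j ≡ s i j) →
                  countPairs r ≡ countPairs s
countPairs-cong {n} r≗s = sum-map-cong (λ i → count-cong (r≗s i) (allFin n)) (allFin n)

countPairs-mono : ∀ {n} {r s : Fin n → Fin n → Bool} → (∀ i j → r i j ≡ true → s i j ≡ true) →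
                  countPairs r ≤ countPairs s
countPairs-mono {n} r⇒s = sum-map-mono (λ i → count-mono (r⇒s i) (allFin n)) (allFin n)

countPairs-before : ∀ {n} (u : Fin n → Bool) →
  countPairs (λ i j → before i j ∧ (u i ∧ u j)) ≡ count u (allFin n) C 2
countPairs-before {zero}  u = refl
countPairs-before {suc n} u = begin
  sum (map pairsFrom (allFin (suc n)))
    ≡⟨ sum-map-allFin-suc pairsFrom ⟩
  pairsFrom Fin.zero + sum (map (pairsFrom ∘ Fin.suc) (allFin n))
    ≡⟨ cong₂ _+_ pairsFrom-zero pairsFrom-suc ⟩
  (if u Fin.zero then c else 0) + c C 2
    ≡⟨ choose-2-suc (u Fin.zero) c ⟩
  ((if u Fin.zero then 1 else 0) + c) C 2
    ≡⟨ cong (_C 2) (count-allFin-suc u) ⟨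
  count u (allFin (suc n)) C 2 ∎
  where
  open ≡-Reasoning
  c = count (u ∘ Fin.suc) (allFin n)
  pair : Fin (suc n) → Fin (suc n) → Bool
  pair i j = before i j ∧ (u i ∧ u j)
  pairsFrom : Fin (suc n) → ℕ
  pairsFrom i = count (pair i) (allFin (suc n))
  pairsFrom-zero : pairsFrom Fin.zero ≡ (if u Fin.zero then c else 0)
  pairsFrom-zero = trans (count-allFin-suc (pair Fin.zero))
                         (count-∧ˡ (u Fin.zero) (u ∘ Fin.suc) (allFin n))
  pairsFrom-suc : sum (map (pairsFrom ∘ Fin.suc) (allFin n)) ≡ c C 2
  pairsFrom-suc =
    trans (sum-map-cong (λ i → count-allFin-suc (pair (Fin.suc i))) (allFin n))
          (countPairs-before (u ∘ Fin.suc))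

count-without : ∀ {n} (u : Fin n → Bool) a → u a ≡ true →
  count (λ v → neqᵇ v a ∧ u v) (allFin n) + 1 ≡ count u (allFin n)
count-without {suc n} u Fin.zero ua = begin
  count (λ v → neqᵇ v Fin.zero ∧ u v) (allFin (suc n)) + 1
    ≡⟨ cong (_+ 1) (count-allFin-suc (λ v → neqᵇ v Fin.zero ∧ u v)) ⟩
  count (u ∘ Fin.suc) (allFin n) + 1
    ≡⟨ +-comm _ 1 ⟩
  1 + count (u ∘ Fin.suc) (allFin n)
    ≡⟨ cong (λ b → (if b then 1 else 0) + count (u ∘ Fin.suc) (allFin n)) ua ⟨
  (if u Fin.zero then 1 else 0) + count (u ∘ Fin.suc) (allFin n)
    ≡⟨ count-allFin-suc u ⟨
  count u (allFin (suc n)) ∎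
  where open ≡-Reasoning
count-without {suc n} u (Fin.suc a) ua = begin
  count (λ v → neqᵇ v (Fin.suc a) ∧ u v) (allFin (suc n)) + 1
    ≡⟨ cong (_+ 1) (count-allFin-suc (λ v → neqᵇ v (Fin.suc a) ∧ u v)) ⟩
  (u₀ + count (λ v → neqᵇ (Fin.suc v) (Fin.suc a) ∧ u (Fin.suc v)) (allFin n)) + 1
    ≡⟨ +-assoc u₀ _ 1 ⟩
  u₀ + (count (λ v → neqᵇ (Fin.suc v) (Fin.suc a) ∧ u (Fin.suc v)) (allFin n) + 1)
    ≡⟨ cong (λ c → u₀ + (c + 1))
            (count-cong (λ v → cong (_∧ u (Fin.suc v)) (neqᵇ-suc v a)) (allFin n)) ⟩
  u₀ + (count (λ v → neqᵇ v a ∧ u (Fin.suc v)) (allFin n) + 1)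
    ≡⟨ cong (u₀ +_) (count-without (u ∘ Fin.suc) a ua) ⟩
  u₀ + count (u ∘ Fin.suc) (allFin n)
    ≡⟨ count-allFin-suc u ⟨
  count u (allFin (suc n)) ∎
  where
  open ≡-Reasoning
  u₀ = if u Fin.zero then 1 else 0

∧≡true : ∀ {x y} → x ∧ y ≡ true → x ≡ true × y ≡ true
∧≡true {true} {true} _ = refl , refl

disjointᵇ-sym : ∀ {n} (e f : Edge n) → disjointᵇ e f ≡ disjointᵇ f e
disjointᵇ-sym (a , b) (c , d)
  rewrite neqᵇ-sym a c | neqᵇ-sym a d | neqᵇ-sym b c | neqᵇ-sym b d =
  solve 4 (λ p q r s → p :* (q :* (r :* s)) := p :* (r :* (q :* s))) refl
        (neqᵇ c a) (neqᵇ d a) (neqᵇ c b) (neqᵇ d b)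

disjointᵇ-irrefl : ∀ {n} (e : Edge n) → disjointᵇ e e ≡ false
disjointᵇ-irrefl (a , b) rewrite neqᵇ-irrefl a = refl

open module Matchings {n} = Cliques (disjointᵇ {n}) disjointᵇ-sym disjointᵇ-irrefl

pairwiseDisjointᵇ≡isClique : ∀ {n} (S : List (Edge n)) → pairwiseDisjointᵇ S ≡ isClique S
pairwiseDisjointᵇ≡isClique []       = refl
pairwiseDisjointᵇ≡isClique (e ∷ es) = cong₂ _∧_ (foldr≡all es) (pairwiseDisjointᵇ≡isClique es)
  where
  foldr≡all : ∀ es → foldr (λ f r → disjointᵇ e f ∧ r) true es ≡ all (disjointᵇ e) es
  foldr≡all []       = refl
  foldr≡all (f ∷ es) = cong (disjointᵇ e f ∧_) (foldr≡all es)

m≡cliques : ∀ {n} (G : Graph n) k → m G k ≡ cliques k (edges G)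
m≡cliques G k = trans (length-filterᵇ pairwiseDisjointᵇ (subsets k (edges G)))
                      (count-cong pairwiseDisjointᵇ≡isClique (subsets k (edges G)))

count-edges : ∀ {n} (G : Graph n) (w : Edge n → Bool) →
  count w (edges G) ≡ countPairs (λ i j → (before i j ∧ adj G i j) ∧ w (i , j))
count-edges {n} G w = begin
  count w (concat (map row (allFin n)))
    ≡⟨ sum-map-concat _ (map row (allFin n)) ⟩
  sum (map (count w) (map row (allFin n)))
    ≡⟨ sum-map-map (count w) row (allFin n) ⟩
  sum (map (count w ∘ row) (allFin n))
    ≡⟨ sum-map-cong count-row (allFin n) ⟩
  countPairs (λ i j → (before i j ∧ adj G i j) ∧ w (i , j)) ∎
  where
  open ≡-Reasoning
  later : Fin n → List (Fin n)
  later i = filterᵇ (λ j → ⌊ toℕ i <? toℕ j ⌋ ∧ adj G i j) (allFin n)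
  row : Fin n → List (Edge n)
  row i = map (i ,_) (later i)
  count-row : ∀ i → count w (row i) ≡ count (λ j → (before i j ∧ adj G i j) ∧ w (i , j)) (allFin n)
  count-row i = begin
    count w (row i)
      ≡⟨ count-map w (i ,_) (later i) ⟩
    count (λ j → w (i , j)) (later i)
      ≡⟨ count-filterᵇ _ _ (allFin n) ⟩
    count (λ j → (⌊ toℕ i <? toℕ j ⌋ ∧ adj G i j) ∧ w (i , j)) (allFin n)
      ≡⟨ count-cong (λ j → cong (λ b → (b ∧ adj G i j) ∧ w (i , j)) (isYes≗does (toℕ i <? toℕ j)))
                    (allFin n) ⟩
    count (λ j → (before i j ∧ adj G i j) ∧ w (i , j)) (allFin n) ∎

Ascending : ∀ {n} → Edge n → Set
Ascending (a , b) = before a b ≡ true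

edges-Ascending : ∀ {n} (G : Graph n) → All Ascending (edges G)
edges-Ascending {n} G = concat⁺ (map⁺ (tabulate⁺ (λ i → map⁺ (row-Ascending i (allFin n)))))
  where
  row-Ascending : ∀ i js →
    All (λ j → before i j ≡ true) (filterᵇ (λ j → ⌊ toℕ i <? toℕ j ⌋ ∧ adj G i j) js)
  row-Ascending i []       = []
  row-Ascending i (j ∷ js) with ⌊ toℕ i <? toℕ j ⌋ ∧ adj G i j in i<j∧adj
  ... | true  = trans (sym (isYes≗does (toℕ i <? toℕ j))) (proj₁ (∧≡true i<j∧adj))
                ∷ row-Ascending i js
  ... | false = row-Ascending i js

uncovered : ∀ {n} → List (Edge n) → Fin n → Bool
uncovered S v = all (λ (a , b) → neqᵇ v a ∧ neqᵇ v b) S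

all-disjointᵇ : ∀ {n} (i j : Fin n) S → all (disjointᵇ (i , j)) S ≡ uncovered S i ∧ uncovered S j
all-disjointᵇ i j []             = refl
all-disjointᵇ i j ((a , b) ∷ S) rewrite all-disjointᵇ i j S =
  solve 6 (λ p q r s x y → (p :* (q :* (r :* s))) :* (x :* y) := ((p :* q) :* x) :* ((r :* s) :* y)) refl
        (neqᵇ i a) (neqᵇ i b) (neqᵇ j a) (neqᵇ j b) (uncovered S i) (uncovered S j)

count-uncovered : ∀ {n} (S : List (Edge n)) → isClique S ≡ true → All Ascending S →
  count (uncovered S) (allFin n) + (length S + length S) ≡ n
count-uncovered {n} []            _        []            =
  trans (+-identityʳ _) (trans (count-true (allFin n)) (length-tabulate id))
count-uncovered {n} ((a , b) ∷ S) matching (a<b ∷ asc) = begin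
  count (uncovered ((a , b) ∷ S)) (allFin n) + (suc L + suc L)
    ≡⟨ regroup (count (uncovered ((a , b) ∷ S)) (allFin n)) L ⟩
  ((count (uncovered ((a , b) ∷ S)) (allFin n) + 1) + 1) + (L + L)
    ≡⟨ cong (λ c → ((c + 1) + 1) + (L + L))
            (count-cong (λ v → ∧-assoc (neqᵇ v a) (neqᵇ v b) (uncovered S v)) (allFin n)) ⟩
  ((count (λ v → neqᵇ v a ∧ (neqᵇ v b ∧ uncovered S v)) (allFin n) + 1) + 1) + (L + L)
    ≡⟨ cong (λ c → (c + 1) + (L + L)) (count-without (λ v → neqᵇ v b ∧ uncovered S v) a a-free) ⟩
  (count (λ v → neqᵇ v b ∧ uncovered S v) (allFin n) + 1) + (L + L)
    ≡⟨ cong (_+ (L + L)) (count-without (uncovered S) b (proj₂ ab-uncovered)) ⟩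
  count (uncovered S) (allFin n) + (L + L)
    ≡⟨ count-uncovered S (proj₂ disjoint×matching) asc ⟩
  n ∎
  where
  open ≡-Reasoning
  L = length S
  regroup : ∀ x l → x + (suc l + suc l) ≡ ((x + 1) + 1) + (l + l)
  regroup = solve-∀
  disjoint×matching = ∧≡true {all (disjointᵇ (a , b)) S} matching
  ab-uncovered = ∧≡true (trans (sym (all-disjointᵇ a b S)) (proj₁ disjoint×matching))
  a-free : neqᵇ a b ∧ uncovered S a ≡ true
  a-free rewrite before⇒neqᵇ a b a<b = proj₁ ab-uncovered

freeEdges : ℕ → ℕ → ℕ
freeEdges n k = (n ∸ (k + k)) C 2

extensions-K : ∀ {n k} (S : List (Edge n)) → isClique S ≡ true → length S ≡ k × All Ascending S →
  extensions (edges (K n)) S ≡ freeEdges n k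
extensions-K {n} S matching (refl , asc) = begin
  extensions (edges (K n)) S
    ≡⟨ count-edges (K n) (λ e → all (disjointᵇ e) S) ⟩
  countPairs (λ i j → (before i j ∧ neqᵇ i j) ∧ all (disjointᵇ (i , j)) S)
    ≡⟨ countPairs-cong (λ i j → cong₂ _∧_ (before-∧-neqᵇ i j) (all-disjointᵇ i j S)) ⟩
  countPairs (λ i j → before i j ∧ (uncovered S i ∧ uncovered S j))
    ≡⟨ countPairs-before (uncovered S) ⟩
  count (uncovered S) (allFin n) C 2
    ≡⟨ cong (_C 2) uncovered-count ⟩
  freeEdges n (length S) ∎
  where
  open ≡-Reasoning
  uncovered-count : count (uncovered S) (allFin n) ≡ n ∸ (length S + length S)
  uncovered-count = sym (trans (cong (_∸ (length S + length S)) (sym (count-uncovered S matching asc)))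
                               (m+n∸n≡m _ (length S + length S)))

extensions-≤-K : ∀ {n} (G : Graph n) S → extensions (edges G) S ≤ extensions (edges (K n)) S
extensions-≤-K {n} G S = begin
  extensions (edges G) S
    ≡⟨ count-edges G w ⟩
  countPairs (λ i j → (before i j ∧ adj G i j) ∧ w (i , j))
    ≤⟨ countPairs-mono (λ i j → drop-adj (before i j) (adj G i j) (w (i , j))) ⟩
  countPairs (λ i j → before i j ∧ w (i , j))
    ≡⟨ countPairs-cong (λ i j → cong (_∧ w (i , j)) (before-∧-neqᵇ i j)) ⟨
  countPairs (λ i j → (before i j ∧ neqᵇ i j) ∧ w (i , j))
    ≡⟨ count-edges (K n) w ⟨
  extensions (edges (K n)) S ∎
  where
  open ≤-Reasoning
  w : Edge n → Bool
  w e = all (disjointᵇ e) S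
  drop-adj : ∀ x a y → (x ∧ a) ∧ y ≡ true → x ∧ y ≡ true
  drop-adj true true true _ = refl

m-K-recurrence : ∀ n k → suc k * m (K n) (suc k) ≡ m (K n) k * freeEdges n k
m-K-recurrence n k rewrite m≡cliques (K n) (suc k) | m≡cliques (K n) k =
  trans (cliques-extension-sum k (edges (K n)))
        (sumWhere-≡ isClique (extensions (edges (K n))) (freeEdges n k) extensions-K
          (subsets-All k (edges-Ascending (K n))))

m-recurrence-≤ : ∀ {n} (G : Graph n) k → suc k * m G (suc k) ≤ m G k * freeEdges n k
m-recurrence-≤ {n} G k rewrite m≡cliques G (suc k) | m≡cliques G k =
  ≤-trans (≤-reflexive (cliques-extension-sum k (edges G)))
          (sumWhere-≤ isClique (extensions (edges G)) (freeEdges n k)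
            (λ S matching shape → ≤-trans (extensions-≤-K G S) (≤-reflexive (extensions-K S matching shape)))
            (subsets-All k (edges-Ascending G)))

module CrossRatio (x y e : ℕ → ℕ)
                  (x-rec : ∀ i → suc i * x (suc i) ≡ x i * e i)
                  (y-rec : ∀ i → suc i * y (suc i) ≤ y i * e i) where

  cross-≤-suc : ∀ {l k} → x l * y k ≤ y l * x k → x l * y (suc k) ≤ y l * x (suc k)
  cross-≤-suc {l} {k} hyp = *-cancelˡ-≤ (suc k) (begin
    suc k * (x l * y (suc k))   ≡⟨ pull (suc k) (x l) (y (suc k)) ⟩
    x l * (suc k * y (suc k))   ≤⟨ *-monoʳ-≤ (x l) (y-rec k) ⟩
    x l * (y k * e k)           ≡⟨ *-assoc (x l) (y k) (e k) ⟨
    (x l * y k) * e k           ≤⟨ *-monoˡ-≤ (e k) hyp ⟩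
    (y l * x k) * e k           ≡⟨ *-assoc (y l) (x k) (e k) ⟩
    y l * (x k * e k)           ≡⟨ cong (y l *_) (x-rec k) ⟨
    y l * (suc k * x (suc k))   ≡⟨ pull (suc k) (y l) (x (suc k)) ⟨
    suc k * (y l * x (suc k))   ∎)
    where
    open ≤-Reasoning
    pull : ∀ s a b → s * (a * b) ≡ a * (s * b)
    pull = solve-∀

  cross-≤ : ∀ {l k} → l ≤ k → x l * y k ≤ y l * x k
  cross-≤ = go ∘ ≤⇒≤′
    where
    go : ∀ {l k} → l ≤′ k → x l * y k ≤ y l * x k
    go {l} ≤′-refl    = ≤-reflexive (*-comm (x l) (y l))
    go (≤′-step l≤′k) = cross-≤-suc (go l≤′k)

  sum-cross-≤ : ∀ {k is} → All (_≤ k) is → sum (map x is) * y k ≤ sum (map y is) * x k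
  sum-cross-≤         []                 = z≤n
  sum-cross-≤ {k} {i ∷ is} (i≤k ∷ is≤k) = begin
    (x i + sum (map x is)) * y k         ≡⟨ *-distribʳ-+ (y k) (x i) (sum (map x is)) ⟩
    x i * y k + sum (map x is) * y k     ≤⟨ +-mono-≤ (cross-≤ i≤k) (sum-cross-≤ is≤k) ⟩
    y i * x k + sum (map y is) * x k     ≡⟨ *-distribʳ-+ (x k) (y i) (sum (map y is)) ⟨
    (y i + sum (map y is)) * x k         ∎
    where open ≤-Reasoning

-- The hypothesis k ≤ μ G only ensures m G k ≠ 0, which the cross-multiplied form does not need.
lemma3p6 : (n : ℕ) (G : Graph n) (k l : ℕ) → k ≤ μ G → l ≤ k →
    (m (K n) l * m G k ≤ m G l * m (K n) k) ×
    (M (K n) l * m G k ≤ M G l * m (K n) k)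
lemma3p6 n G k l _ l≤k =
  cross-≤ l≤k ,
  sum-cross-≤ (applyUpTo⁺₁ id (suc l) (λ i<1+l → ≤-trans (m<1+n⇒m≤n i<1+l) l≤k))
  where open CrossRatio (m (K n)) (m G) (freeEdges n) (m-K-recurrence n) (m-recurrence-≤ G)
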